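{- Let $g$ be a formal variable and let $R,S\in\mathbb{Q}[[g]]$ be the unique formal power series with $R=1+O(g)$ and $S=O(g)$ satisfying $$S=2gR+gS^2,\qquad R=1+2gRS.$$ Let $x\in\mathbb{Q}[[g]]$ be the unique formal power series with zero constant term satisfying $x=g^2R^3(1+x)^2$ (equivalently $1-g^2R^3\left(x+\frac1x+2\right)=0$). For integers $n\ge -1$ define $$R_n=R\,\frac{(1-x^{n+1})(1-x^{n+3})}{(1-x^{n+2})^2},$$ so that $R_{ -1}=0$, and for $n\ge 0$ define $$S_n=S-gR^2\,\frac{(1-x)(1-x^2)\,x^n}{(1-x^{n+1})(1-x^{n+2})}.$$ Then for all $n\ge 0$, $$S_n=g(R_n+R_{n-1})+gS_n^2,\qquad R_n=1+gR_n(S_{n+1}+S_n).$$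
   Context: All identities are identities of formal power series in $g$; the quotients are well defined since $1-x^k$ is invertible in $\mathbb{Q}[[g]]$ for $k\ge1$. Combinatorially, $R_n$ (resp. $S_n$) is the generating function, with weight $g$ per vertex, of planar trivalent graphs with two legs (resp. one leg) such that the geodesic distance between the external face and the face adjacent to the (outgoing) leg is at most $n$; the claim is the exact solution of the displayed recursion with boundary condition $R_{ -1}=0$. -}

module Defs where

open import Data.Nat using (ℕ; zero; suc; _∸_)
open import Data.Rational using (ℚ; 0ℚ; 1ℚ; _+_; _*_; -_)
open import Data.List using (List; []; _∷_; map; foldr; zipWith; upTo; applyUpTo)
open import Relation.Binary.PropositionalEquality using (_≡_)

FPS : Set
FPS = ℕ → ℚ

infix 4 _≈_
_≈_ : FPS → FPS → Set
f ≈ h = ∀ n → f n ≡ h n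

sumℚ : List ℚ → ℚ
sumℚ = foldr _+_ 0ℚ

const : ℚ → FPS
const c zero    = c
const c (suc _) = 0ℚ

𝟘 𝟙 𝟚 : FPS
𝟘 = const 0ℚ
𝟙 = const 1ℚ
𝟚 = const (1ℚ + 1ℚ)

gvar : FPS
gvar 1 = 1ℚ
gvar _ = 0ℚ

infixl 6 _⊕_ _⊖_
infixl 7 _⊛_
infixr 8 _^^_

_⊕_ : FPS → FPS → FPS
(f ⊕ h) n = f n + h n

⊝_ : FPS → FPS
(⊝ f) n = - (f n)

_⊖_ : FPS → FPS → FPS
f ⊖ h = f ⊕ (⊝ h)

_⊛_ : FPS → FPS → FPS
(f ⊛ h) n = sumℚ (map (λ k → f k * h (n ∸ k)) (upTo (suc n)))

_^^_ : FPS → ℕ → FPS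
f ^^ zero  = 𝟙
f ^^ suc k = f ⊛ (f ^^ k)

-- Multiplicative inverse of a power series whose constant term is 1:
-- b₀ = 1, bₙ = - Σ_{k=1}^{n} fₖ b_{n-k}.  (The constant term of f is not
-- read; this is the inverse of f exactly when f 0 ≡ 1, which holds for all
-- series 1 - x^k, k ≥ 1, inverted below since x has zero constant term.)
invList : FPS → ℕ → List ℚ   -- [bₙ, …, b₀]
invList f zero    = 1ℚ ∷ []
invList f (suc n) =
  let bs = invList f n in
  (- sumℚ (zipWith _*_ (applyUpTo (λ k → f (suc k)) (suc n)) bs)) ∷ bs

inv1 : FPS → FPS
inv1 f n with invList f n
... | b ∷ _ = b
... | []    = 0ℚ

-- Rs m  =  R_{m-1}  (so Rs 0 = R_{-1}), for m ≥ 0: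
-- R_n = R (1-x^{n+1})(1-x^{n+3}) / (1-x^{n+2})^2
Rs : FPS → FPS → ℕ → FPS
Rs R x m = R ⊛ (𝟙 ⊖ x ^^ m) ⊛ (𝟙 ⊖ x ^^ (suc (suc m)))
             ⊛ inv1 ((𝟙 ⊖ x ^^ suc m) ⊛ (𝟙 ⊖ x ^^ suc m))

Sn : FPS → FPS → FPS → ℕ → FPS
Sn R S x n = S ⊖ gvar ⊛ R ^^ 2 ⊛ (𝟙 ⊖ x) ⊛ (𝟙 ⊖ x ^^ 2) ⊛ x ^^ n
               ⊛ inv1 ((𝟙 ⊖ x ^^ suc n) ⊛ (𝟙 ⊖ x ^^ suc (suc n)))

{-# OPTIONS --safe #-}
module Submission where

-- Everything is an identity in the commutative ring ℚ[[g]].  Put y = xⁿ and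
-- P, Q, T = 1 - x^{n+1}, 1 - x^{n+2}, 1 - x^{n+3}, κ = (1 - x)(1 - x²); then
-- R_n = R·PT/Q², R_{n-1} = R(1 - y)Q/P² and S_n = S - gR²κ·y/(PQ).  The system
-- gives R(1 - 2gS) = 1, S - gS² = 2gR, and (from x = g²R³(1 + x)², since
-- κ = (1 - x)²(1 + x)) g²R³κ(1 + x) = x(1 - x)².  With these substitutions the
-- S-recursion reduces to the polynomial identity
--   2P²Q² - κ·yPQ - x(1 - x)⁴y² = P³T + (1 - y)Q³,
-- and the R-recursion to Q² = PT + x(1 - x)²y and T + xP = (1 + x)Q.  The
-- denominators are units because x has no constant term.

open import Defs
open import Algebra.Bundles using (CommutativeRing)
import Algebra.Consequences.Setoid as Consequences
open import Algebra.Solver.Ring.AlmostCommutativeRing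
  using (_-Raw-AlmostCommutative⟶_; fromCommutativeRing)
import Algebra.Solver.Ring as RingSolver
open import Algebra.Structures using (IsCommutativeRing)
open import Data.List using (_∷_; map; zipWith; applyUpTo; upTo)
open import Data.List.Properties using (map-applyUpTo; map-cong)
open import Data.Maybe as Maybe using (Maybe)
open import Data.Nat using (ℕ; zero; suc; _∸_)
open import Algebra.Construct.Pointwise ℕ using (isEquivalence)
open import Data.Product using (_×_; _,_; proj₂)
open import Data.Rational using (ℚ; 0ℚ; 1ℚ; _+_; _*_; -_)
import Data.Rational.Properties as ℚ
open import Data.Rational.Solver using (module +-*-Solver)
open import Function using (_∘_)
open import Level using (0ℓ)
open import Relation.Binary.Bundles using (Setoid)
open import Relation.Binary.Consequences using (dec⇒weaklyDec)
open import Relation.Binary.PropositionalEquality as ≡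
  using (_≡_; refl; cong; cong₂; module ≡-Reasoning)
import Relation.Binary.Reasoning.Setoid as SetoidReasoning

module PowerSeriesRing where

  open +-*-Solver using (solve; _:+_; _:*_; _:=_; con)

  tail : FPS → FPS
  tail f k = f (suc k)

  ⊛-suc : ∀ f h n → (f ⊛ h) (suc n) ≡ f 0 * h (suc n) + (tail f ⊛ h) n
  ⊛-suc f h n = cong (λ l → f 0 * h (suc n) + sumℚ l)
    (≡.trans (map-applyUpTo suc (λ k → f k * h (suc n ∸ k)) (suc n))
             (≡.sym (map-applyUpTo (λ k → k) (λ k → f (suc k) * h (n ∸ k)) (suc n))))

  ⊛-sucʳ : ∀ f h n → (f ⊛ h) (suc n) ≡ (f ⊛ tail h) n + f (suc n) * h 0
  ⊛-sucʳ f h zero =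
    solve 4 (λ a b c d → a :* b :+ (c :* d :+ con 0ℚ) := (a :* b :+ con 0ℚ) :+ c :* d)
      refl (f 0) (h 1) (f 1) (h 0)
  ⊛-sucʳ f h (suc n) = begin
    (f ⊛ h) (suc (suc n))                              ≡⟨ ⊛-suc f h (suc n) ⟩
    c₀ + (tail f ⊛ h) (suc n)                          ≡⟨ cong (c₀ +_) (⊛-sucʳ (tail f) h n) ⟩
    c₀ + ((tail f ⊛ tail h) n + f (suc (suc n)) * h 0) ≡⟨ ℚ.+-assoc c₀ _ _ ⟨
    c₀ + (tail f ⊛ tail h) n + f (suc (suc n)) * h 0
      ≡⟨ cong (_+ f (suc (suc n)) * h 0) (⊛-suc f (tail h) n) ⟨
    (f ⊛ tail h) (suc n) + f (suc (suc n)) * h 0       ∎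
    where
    open ≡-Reasoning
    c₀ : ℚ
    c₀ = f 0 * h (suc (suc n))

  ⊛-cong : ∀ {f f′ h h′} → f ≈ f′ → h ≈ h′ → f ⊛ h ≈ f′ ⊛ h′
  ⊛-cong f≈f′ h≈h′ n =
    cong sumℚ (map-cong (λ k → cong₂ _*_ (f≈f′ k) (h≈h′ (n ∸ k))) (upTo (suc n)))

  ⊛-comm : ∀ f h → f ⊛ h ≈ h ⊛ f
  ⊛-comm f h zero    = cong (_+ 0ℚ) (ℚ.*-comm (f 0) (h 0))
  ⊛-comm f h (suc n) = begin
    (f ⊛ h) (suc n)                  ≡⟨ ⊛-suc f h n ⟩
    f 0 * h (suc n) + (tail f ⊛ h) n ≡⟨ cong (f 0 * h (suc n) +_) (⊛-comm (tail f) h n) ⟩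
    f 0 * h (suc n) + (h ⊛ tail f) n ≡⟨ ℚ.+-comm (f 0 * h (suc n)) _ ⟩
    (h ⊛ tail f) n + f 0 * h (suc n) ≡⟨ cong ((h ⊛ tail f) n +_) (ℚ.*-comm (f 0) (h (suc n))) ⟩
    (h ⊛ tail f) n + h (suc n) * f 0 ≡⟨ ⊛-sucʳ h f n ⟨
    (h ⊛ f) (suc n)                  ∎
    where open ≡-Reasoning

  0-⊛ : ∀ h n → ((λ _ → 0ℚ) ⊛ h) n ≡ 0ℚ
  0-⊛ h zero    = cong (_+ 0ℚ) (ℚ.*-zeroˡ (h 0))
  0-⊛ h (suc n) =
    ≡.trans (⊛-suc (λ _ → 0ℚ) h n) (cong₂ _+_ (ℚ.*-zeroˡ (h (suc n))) (0-⊛ h n))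

  const-⊛ : ∀ a h n → (const a ⊛ h) n ≡ a * h n
  const-⊛ a h zero    = ℚ.+-identityʳ (a * h 0)
  const-⊛ a h (suc n) = ≡.trans (⊛-suc (const a) h n)
    (≡.trans (cong (a * h (suc n) +_) (0-⊛ h n)) (ℚ.+-identityʳ (a * h (suc n))))

  scale-⊛ : ∀ a f h n → ((λ k → a * f k) ⊛ h) n ≡ a * (f ⊛ h) n
  scale-⊛ a f h zero =
    solve 3 (λ a x y → (a :* x) :* y :+ con 0ℚ := a :* (x :* y :+ con 0ℚ)) refl a (f 0) (h 0)
  scale-⊛ a f h (suc n) = begin
    ((λ k → a * f k) ⊛ h) (suc n)                      ≡⟨ ⊛-suc (λ k → a * f k) h n ⟩
    a * f 0 * h (suc n) + ((λ k → a * tail f k) ⊛ h) n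
      ≡⟨ cong (a * f 0 * h (suc n) +_) (scale-⊛ a (tail f) h n) ⟩
    a * f 0 * h (suc n) + a * (tail f ⊛ h) n
      ≡⟨ solve 4 (λ a x y z → (a :* x) :* y :+ a :* z := a :* (x :* y :+ z))
           refl a (f 0) (h (suc n)) ((tail f ⊛ h) n) ⟩
    a * (f 0 * h (suc n) + (tail f ⊛ h) n)             ≡⟨ cong (a *_) (⊛-suc f h n) ⟨
    a * (f ⊛ h) (suc n)                                ∎
    where open ≡-Reasoning

  ⊛-distribˡ : ∀ f h k → f ⊛ (h ⊕ k) ≈ f ⊛ h ⊕ f ⊛ k
  ⊛-distribˡ f h k zero =
    solve 3 (λ a b c → a :* (b :+ c) :+ con 0ℚ := (a :* b :+ con 0ℚ) :+ (a :* c :+ con 0ℚ))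
      refl (f 0) (h 0) (k 0)
  ⊛-distribˡ f h k (suc n) = begin
    (f ⊛ (h ⊕ k)) (suc n)                                ≡⟨ ⊛-suc f (h ⊕ k) n ⟩
    f 0 * (h (suc n) + k (suc n)) + (tail f ⊛ (h ⊕ k)) n
      ≡⟨ cong (f 0 * (h (suc n) + k (suc n)) +_) (⊛-distribˡ (tail f) h k n) ⟩
    f 0 * (h (suc n) + k (suc n)) + ((tail f ⊛ h) n + (tail f ⊛ k) n)
      ≡⟨ solve 5 (λ a b c d e → a :* (b :+ c) :+ (d :+ e) := (a :* b :+ d) :+ (a :* c :+ e))
           refl (f 0) (h (suc n)) (k (suc n)) ((tail f ⊛ h) n) ((tail f ⊛ k) n) ⟩
    (f 0 * h (suc n) + (tail f ⊛ h) n) + (f 0 * k (suc n) + (tail f ⊛ k) n)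
      ≡⟨ cong₂ _+_ (⊛-suc f h n) (⊛-suc f k n) ⟨
    (f ⊛ h) (suc n) + (f ⊛ k) (suc n)                    ∎
    where open ≡-Reasoning

  FPS-setoid : Setoid 0ℓ 0ℓ
  FPS-setoid = record
    { Carrier = FPS ; _≈_ = _≈_ ; isEquivalence = isEquivalence ≡.isEquivalence }

  open Consequences FPS-setoid using (comm∧idˡ⇒id; comm∧distrˡ⇒distr)

  ⊛-distrib : (∀ f h k → f ⊛ (h ⊕ k) ≈ f ⊛ h ⊕ f ⊛ k)
            × (∀ f h k → (h ⊕ k) ⊛ f ≈ h ⊛ f ⊕ k ⊛ f)
  ⊛-distrib = comm∧distrˡ⇒distr (λ p q n → cong₂ _+_ (p n) (q n)) ⊛-comm ⊛-distribˡ

  ⊛-assoc : ∀ f h k → (f ⊛ h) ⊛ k ≈ f ⊛ (h ⊛ k)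
  ⊛-assoc f h k zero =
    solve 3 (λ a b c → (a :* b :+ con 0ℚ) :* c :+ con 0ℚ := a :* (b :* c :+ con 0ℚ) :+ con 0ℚ)
      refl (f 0) (h 0) (k 0)
  ⊛-assoc f h k (suc n) = begin
    ((f ⊛ h) ⊛ k) (suc n)                 ≡⟨ ⊛-suc (f ⊛ h) k n ⟩
    c₀ + (tail (f ⊛ h) ⊛ k) n             ≡⟨ cong (c₀ +_) (⊛-cong {h = k} (⊛-suc f h) (λ _ → refl) n) ⟩
    c₀ + ((f₀·tail-h ⊕ tail f ⊛ h) ⊛ k) n ≡⟨ cong (c₀ +_) (proj₂ ⊛-distrib k f₀·tail-h (tail f ⊛ h) n) ⟩
    c₀ + ((f₀·tail-h ⊛ k) n + ((tail f ⊛ h) ⊛ k) n)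
      ≡⟨ cong (c₀ +_) (cong₂ _+_ (scale-⊛ (f 0) (tail h) k n) (⊛-assoc (tail f) h k n)) ⟩
    c₀ + (f 0 * (tail h ⊛ k) n + (tail f ⊛ (h ⊛ k)) n)
      ≡⟨ solve 5 (λ a b c d e → (a :* b :+ con 0ℚ) :* c :+ (a :* d :+ e) := a :* (b :* c :+ d) :+ e)
           refl (f 0) (h 0) (k (suc n)) ((tail h ⊛ k) n) ((tail f ⊛ (h ⊛ k)) n) ⟩
    f 0 * (h 0 * k (suc n) + (tail h ⊛ k) n) + (tail f ⊛ (h ⊛ k)) n
      ≡⟨ cong (λ z → f 0 * z + (tail f ⊛ (h ⊛ k)) n) (⊛-suc h k n) ⟨
    f 0 * (h ⊛ k) (suc n) + (tail f ⊛ (h ⊛ k)) n ≡⟨ ⊛-suc f (h ⊛ k) n ⟨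
    (f ⊛ (h ⊛ k)) (suc n)                 ∎
    where
    open ≡-Reasoning
    c₀ : ℚ
    c₀ = (f ⊛ h) 0 * k (suc n)
    f₀·tail-h : FPS
    f₀·tail-h m = f 0 * tail h m

  ⊛-identityˡ : ∀ f → 𝟙 ⊛ f ≈ f
  ⊛-identityˡ f n = ≡.trans (const-⊛ 1ℚ f n) (ℚ.*-identityˡ (f n))

  𝟘-coeff : ∀ n → 𝟘 n ≡ 0ℚ
  𝟘-coeff zero    = refl
  𝟘-coeff (suc n) = refl

  FPS-isCommutativeRing : IsCommutativeRing _≈_ _⊕_ _⊛_ ⊝_ 𝟘 𝟙
  FPS-isCommutativeRing = record
    { isRing = record
      { +-isAbelianGroup = record
        { isGroup = record
          { isMonoid = record
            { isSemigroup = record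
              { isMagma = record
                { isEquivalence = Setoid.isEquivalence FPS-setoid
                ; ∙-cong        = λ p q n → cong₂ _+_ (p n) (q n)
                }
              ; assoc = λ f h k n → ℚ.+-assoc (f n) (h n) (k n)
              }
            ; identity = (λ f n → ≡.trans (cong (_+ f n) (𝟘-coeff n)) (ℚ.+-identityˡ (f n)))
                       , (λ f n → ≡.trans (cong (f n +_) (𝟘-coeff n)) (ℚ.+-identityʳ (f n)))
            }
          ; inverse = (λ f n → ≡.trans (ℚ.+-inverseˡ (f n)) (≡.sym (𝟘-coeff n)))
                    , (λ f n → ≡.trans (ℚ.+-inverseʳ (f n)) (≡.sym (𝟘-coeff n)))
          ; ⁻¹-cong = λ p n → cong -_ (p n)
          }
        ; comm = λ f h n → ℚ.+-comm (f n) (h n)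
        }
      ; *-cong     = ⊛-cong
      ; *-assoc    = ⊛-assoc
      ; *-identity = comm∧idˡ⇒id ⊛-comm ⊛-identityˡ
      ; distrib    = ⊛-distrib
      }
    ; *-comm = ⊛-comm
    }

  FPS-ring : CommutativeRing 0ℓ 0ℓ
  FPS-ring = record { isCommutativeRing = FPS-isCommutativeRing }

  const-homomorphism : CommutativeRing.rawRing ℚ.+-*-commutativeRing
                         -Raw-AlmostCommutative⟶ fromCommutativeRing FPS-ring
  const-homomorphism = record
    { ⟦_⟧    = const
    ; +-homo = λ a b → λ { zero → refl ; (suc n) → refl }
    ; *-homo = λ a b n → ≡.sym (≡.trans (const-⊛ a (const b) n) (*-const a b n))
    ; -‿homo = λ a → λ { zero → refl ; (suc n) → refl }
    ; 0-homo = λ _ → refl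
    ; 1-homo = λ _ → refl
    }
    where
    *-const : ∀ a b n → a * const b n ≡ const (a * b) n
    *-const a b zero    = refl
    *-const a b (suc n) = ℚ.*-zeroʳ a

  const-≟ : ∀ a b → Maybe (const a ≈ const b)
  const-≟ a b = Maybe.map (λ a≡b n → cong (λ c → const c n) a≡b) (dec⇒weaklyDec ℚ._≟_ a b)

  zipWith-applyUpTo : ∀ {A B C : Set} (_∙_ : A → B → C) f g n →
    zipWith _∙_ (applyUpTo f n) (applyUpTo g n) ≡ applyUpTo (λ k → f k ∙ g k) n
  zipWith-applyUpTo _∙_ f g zero    = refl
  zipWith-applyUpTo _∙_ f g (suc n) =
    cong (f 0 ∙ g 0 ∷_) (zipWith-applyUpTo _∙_ (f ∘ suc) (g ∘ suc) n)

  invList-applyUpTo : ∀ f n → invList f n ≡ applyUpTo (λ k → inv1 f (n ∸ k)) (suc n)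
  invList-applyUpTo f zero    = refl
  invList-applyUpTo f (suc n) = cong (inv1 f (suc n) ∷_) (invList-applyUpTo f n)

  inv1-suc : ∀ f n → inv1 f (suc n) ≡ - (tail f ⊛ inv1 f) n
  inv1-suc f n = cong (λ l → - sumℚ l) (begin
    zipWith _*_ (applyUpTo (tail f) (suc n)) (invList f n)
      ≡⟨ cong (zipWith _*_ (applyUpTo (tail f) (suc n))) (invList-applyUpTo f n) ⟩
    zipWith _*_ (applyUpTo (tail f) (suc n)) (applyUpTo (λ k → inv1 f (n ∸ k)) (suc n))
      ≡⟨ zipWith-applyUpTo _*_ (tail f) (λ k → inv1 f (n ∸ k)) (suc n) ⟩
    applyUpTo (λ k → tail f k * inv1 f (n ∸ k)) (suc n)
      ≡⟨ map-applyUpTo (λ k → k) (λ k → tail f k * inv1 f (n ∸ k)) (suc n) ⟨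
    map (λ k → tail f k * inv1 f (n ∸ k)) (upTo (suc n))
      ∎)
    where open ≡-Reasoning

  inv1-inverse : ∀ f → f 0 ≡ 1ℚ → f ⊛ inv1 f ≈ 𝟙
  inv1-inverse f f₀≡1 zero    = cong (λ c → c * 1ℚ + 0ℚ) f₀≡1
  inv1-inverse f f₀≡1 (suc n) = begin
    (f ⊛ inv1 f) (suc n)     ≡⟨ ⊛-suc f (inv1 f) n ⟩
    f 0 * inv1 f (suc n) + s ≡⟨ cong₂ (λ c d → c * d + s) f₀≡1 (inv1-suc f n) ⟩
    1ℚ * - s + s             ≡⟨ cong (_+ s) (ℚ.*-identityˡ (- s)) ⟩
    - s + s                  ≡⟨ ℚ.+-inverseˡ s ⟩
    0ℚ                       ∎
    where
    open ≡-Reasoning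
    s : ℚ
    s = (tail f ⊛ inv1 f) n

  1⊖-coeff₀ : ∀ x f → x 0 ≡ 0ℚ → (𝟙 ⊖ x ⊛ f) 0 ≡ 1ℚ
  1⊖-coeff₀ x f x₀≡0 =
    cong (λ c → 1ℚ + - (c + 0ℚ)) (≡.trans (cong (_* f 0) x₀≡0) (ℚ.*-zeroˡ (f 0)))

  ⊛-coeff₀ : ∀ f h → f 0 ≡ 1ℚ → h 0 ≡ 1ℚ → (f ⊛ h) 0 ≡ 1ℚ
  ⊛-coeff₀ f h f₀≡1 h₀≡1 = cong₂ (λ a b → a * b + 0ℚ) f₀≡1 h₀≡1

open PowerSeriesRing
  using (FPS-setoid; FPS-ring; const-homomorphism; const-≟; inv1-inverse; 1⊖-coeff₀; ⊛-coeff₀)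
open CommutativeRing FPS-ring
  using ( +-cong; +-congˡ; +-congʳ; -‿cong
        ; *-cong; *-congˡ; *-congʳ; *-identityˡ; *-identityʳ; *-assoc )
  renaming (refl to ≈-refl; sym to ≈-sym; trans to ≈-trans)
open import Algebra.Properties.Semiring.Exp (CommutativeRing.semiring FPS-ring) using (^-congˡ)
open SetoidReasoning FPS-setoid
open RingSolver (CommutativeRing.rawRing ℚ.+-*-commutativeRing) (fromCommutativeRing FPS-ring)
  const-homomorphism const-≟
  using (solve; _:+_; _:-_; _:*_; _:^_; _:=_; con)

inverse-cancel : ∀ a b → a ⊛ b ≈ 𝟙 → ∀ f → b ⊛ (a ⊛ f) ≈ f
inverse-cancel a b ab≈1 f = begin
  b ⊛ (a ⊛ f) ≈⟨ solve 3 (λ a b f → b :* (a :* f) := a :* b :* f) ≈-refl a b f ⟩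
  a ⊛ b ⊛ f   ≈⟨ *-congʳ {f} ab≈1 ⟩
  𝟙 ⊛ f       ≈⟨ *-identityˡ f ⟩
  f           ∎

unit-cancel : ∀ a b {f h} → a ⊛ b ≈ 𝟙 → a ⊛ f ≈ a ⊛ h → f ≈ h
unit-cancel a b {f} {h} ab≈1 af≈ah = begin
  f           ≈⟨ inverse-cancel a b ab≈1 f ⟨
  b ⊛ (a ⊛ f) ≈⟨ *-congˡ {b} af≈ah ⟩
  b ⊛ (a ⊛ h) ≈⟨ inverse-cancel a b ab≈1 h ⟩
  h           ∎

fraction-cancel : ∀ a b → a ⊛ b ≈ 𝟙 → ∀ f → a ⊛ (f ⊛ b) ≈ f
fraction-cancel a b ab≈1 f = begin
  a ⊛ (f ⊛ b) ≈⟨ solve 3 (λ a b f → a :* (f :* b) := f :* (a :* b)) ≈-refl a b f ⟩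
  f ⊛ (a ⊛ b) ≈⟨ *-congˡ {f} ab≈1 ⟩
  f ⊛ 𝟙       ≈⟨ *-identityʳ f ⟩
  f           ∎

absorbʳ : ∀ f {a} → a ≈ 𝟙 → f ⊛ a ≈ f
absorbʳ f a≈1 = ≈-trans (*-congˡ {f} a≈1) (*-identityʳ f)

κ : FPS → FPS
κ x = (𝟙 ⊖ x) ⊛ (𝟙 ⊖ x ^^ 2)

-- y stands for xⁿ.  A quotient by a unit d is carried as a witness u with
-- d ⊛ u ≈ 𝟙, and z = y/(PQ) as a hypothesis P ⊛ Q ⊛ z ≈ y.
module Denominators (x y : FPS) where

  P Q T : FPS
  P = 𝟙 ⊖ x ⊛ y
  Q = 𝟙 ⊖ x ⊛ (x ⊛ y)
  T = 𝟙 ⊖ x ⊛ (x ⊛ (x ⊛ y))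

  Q²≈PT+x[1-x]²y : Q ⊛ Q ≈ P ⊛ T ⊕ x ⊛ (𝟙 ⊖ x) ^^ 2 ⊛ y
  Q²≈PT+x[1-x]²y = solve 2 (λ x y →
       (con 1ℚ :- x :* (x :* y)) :* (con 1ℚ :- x :* (x :* y))
    := (con 1ℚ :- x :* y) :* (con 1ℚ :- x :* (x :* (x :* y))) :+ x :* (con 1ℚ :- x) :^ 2 :* y)
    ≈-refl x y

  T+xP≈[1+x]Q : T ⊕ x ⊛ P ≈ (𝟙 ⊕ x) ⊛ Q
  T+xP≈[1+x]Q = solve 2 (λ x y →
       con 1ℚ :- x :* (x :* (x :* y)) :+ x :* (con 1ℚ :- x :* y)
    := (con 1ℚ :+ x) :* (con 1ℚ :- x :* (x :* y)))
    ≈-refl x y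

  quartic-identity : 𝟚 ⊛ (P ⊛ Q) ^^ 2 ⊖ κ x ⊛ (P ⊛ Q) ⊛ y ⊖ x ⊛ (𝟙 ⊖ x) ^^ 4 ⊛ y ^^ 2
                   ≈ P ^^ 3 ⊛ T ⊕ (𝟙 ⊖ y) ⊛ Q ^^ 3
  quartic-identity = solve 2 (λ x y →
    let P = con 1ℚ :- x :* y
        Q = con 1ℚ :- x :* (x :* y)
        T = con 1ℚ :- x :* (x :* (x :* y))
    in     con (1ℚ + 1ℚ) :* (P :* Q) :^ 2 :- (con 1ℚ :- x) :* (con 1ℚ :- x :^ 2) :* (P :* Q) :* y
             :- x :* (con 1ℚ :- x) :^ 4 :* y :^ 2
        := P :^ 3 :* T :+ (con 1ℚ :- y) :* Q :^ 3)
    ≈-refl x y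

  1-x[1-x]²y/Q²≈PT/Q² : ∀ {u} → Q ⊛ Q ⊛ u ≈ 𝟙 → 𝟙 ⊖ x ⊛ (𝟙 ⊖ x) ^^ 2 ⊛ (y ⊛ u) ≈ P ⊛ T ⊛ u
  1-x[1-x]²y/Q²≈PT/Q² {u} Q²u≈1 = begin
    𝟙 ⊖ d
      ≈⟨ +-congʳ {⊝ d} (≈-trans (≈-sym Q²u≈1) (*-congʳ {u} Q²≈PT+x[1-x]²y)) ⟩
    (P ⊛ T ⊕ x ⊛ (𝟙 ⊖ x) ^^ 2 ⊛ y) ⊛ u ⊖ d
      ≈⟨ solve 5 (λ P T x y u →
              (P :* T :+ x :* (con 1ℚ :- x) :^ 2 :* y) :* u :- x :* (con 1ℚ :- x) :^ 2 :* (y :* u)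
           := P :* T :* u) ≈-refl P T x y u ⟩
    P ⊛ T ⊛ u
      ∎
    where
    d : FPS
    d = x ⊛ (𝟙 ⊖ x) ^^ 2 ⊛ (y ⊛ u)

  PT[z₀+z₁]≈[1+x]y : ∀ {u z₀ z₁} → Q ⊛ Q ⊛ u ≈ 𝟙 → P ⊛ Q ⊛ z₀ ≈ y → Q ⊛ T ⊛ z₁ ≈ x ⊛ y →
                     P ⊛ T ⊛ (z₀ ⊕ z₁) ≈ (𝟙 ⊕ x) ⊛ y
  PT[z₀+z₁]≈[1+x]y {u} {z₀} {z₁} Q²u≈1 PQz₀≈y QTz₁≈xy =
    unit-cancel Q (Q ⊛ u) (≈-trans (≈-sym (*-assoc Q Q u)) Q²u≈1) (begin
      Q ⊛ (P ⊛ T ⊛ (z₀ ⊕ z₁))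
        ≈⟨ solve 5 (λ P Q T z₀ z₁ → Q :* (P :* T :* (z₀ :+ z₁)) := T :* (P :* Q :* z₀) :+ P :* (Q :* T :* z₁))
             ≈-refl P Q T z₀ z₁ ⟩
      T ⊛ (P ⊛ Q ⊛ z₀) ⊕ P ⊛ (Q ⊛ T ⊛ z₁)
        ≈⟨ +-cong (*-congˡ {T} PQz₀≈y) (*-congˡ {P} QTz₁≈xy) ⟩
      T ⊛ y ⊕ P ⊛ (x ⊛ y)
        ≈⟨ solve 4 (λ P T x y → T :* y :+ P :* (x :* y) := (T :+ x :* P) :* y) ≈-refl P T x y ⟩
      (T ⊕ x ⊛ P) ⊛ y
        ≈⟨ *-congʳ {y} T+xP≈[1+x]Q ⟩
      (𝟙 ⊕ x) ⊛ Q ⊛ y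
        ≈⟨ solve 3 (λ Q x y → (con 1ℚ :+ x) :* Q :* y := Q :* ((con 1ℚ :+ x) :* y)) ≈-refl Q x y ⟩
      Q ⊛ ((𝟙 ⊕ x) ⊛ y)
        ∎)

  2-κz-x[1-x]⁴z²≈PT/Q²+[1-y]Q/P² :
    ∀ {u₁ u₂ z} → P ⊛ P ⊛ u₁ ≈ 𝟙 → Q ⊛ Q ⊛ u₂ ≈ 𝟙 → P ⊛ Q ⊛ z ≈ y →
    𝟚 ⊖ κ x ⊛ z ⊖ x ⊛ (𝟙 ⊖ x) ^^ 4 ⊛ z ^^ 2 ≈ P ⊛ T ⊛ u₂ ⊕ (𝟙 ⊖ y) ⊛ Q ⊛ u₁
  2-κz-x[1-x]⁴z²≈PT/Q²+[1-y]Q/P² {u₁} {u₂} {z} P²u₁≈1 Q²u₂≈1 PQz≈y =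
    unit-cancel ((P ⊛ Q) ^^ 2) (u₁ ⊛ u₂) [PQ]²u₁u₂≈1 (begin
      (P ⊛ Q) ^^ 2 ⊛ (𝟚 ⊖ κ x ⊛ z ⊖ c ⊛ z ^^ 2)
        ≈⟨ solve 5 (λ P Q x z c →
                (P :* Q) :^ 2 :* (con (1ℚ + 1ℚ) :- (con 1ℚ :- x) :* (con 1ℚ :- x :^ 2) :* z :- c :* z :^ 2)
             := con (1ℚ + 1ℚ) :* (P :* Q) :^ 2
                  :- (con 1ℚ :- x) :* (con 1ℚ :- x :^ 2) :* (P :* Q) :* (P :* Q :* z)
                  :- c :* (P :* Q :* z) :^ 2) ≈-refl P Q x z c ⟩
      𝟚 ⊛ (P ⊛ Q) ^^ 2 ⊖ κ x ⊛ (P ⊛ Q) ⊛ (P ⊛ Q ⊛ z) ⊖ c ⊛ (P ⊛ Q ⊛ z) ^^ 2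
        ≈⟨ +-cong (+-congˡ {𝟚 ⊛ (P ⊛ Q) ^^ 2} (-‿cong (*-congˡ {κ x ⊛ (P ⊛ Q)} PQz≈y)))
                  (-‿cong (*-congˡ {c} (^-congˡ 2 PQz≈y))) ⟩
      𝟚 ⊛ (P ⊛ Q) ^^ 2 ⊖ κ x ⊛ (P ⊛ Q) ⊛ y ⊖ c ⊛ y ^^ 2
        ≈⟨ quartic-identity ⟩
      P ^^ 3 ⊛ T ⊕ (𝟙 ⊖ y) ⊛ Q ^^ 3
        ≈⟨ +-cong (absorbʳ (P ^^ 3 ⊛ T) Q²u₂≈1) (absorbʳ ((𝟙 ⊖ y) ⊛ Q ^^ 3) P²u₁≈1) ⟨
      P ^^ 3 ⊛ T ⊛ (Q ⊛ Q ⊛ u₂) ⊕ (𝟙 ⊖ y) ⊛ Q ^^ 3 ⊛ (P ⊛ P ⊛ u₁)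
        ≈⟨ solve 6 (λ P Q T y u₁ u₂ →
                P :^ 3 :* T :* (Q :* Q :* u₂) :+ (con 1ℚ :- y) :* Q :^ 3 :* (P :* P :* u₁)
             := (P :* Q) :^ 2 :* (P :* T :* u₂ :+ (con 1ℚ :- y) :* Q :* u₁)) ≈-refl P Q T y u₁ u₂ ⟩
      (P ⊛ Q) ^^ 2 ⊛ (P ⊛ T ⊛ u₂ ⊕ (𝟙 ⊖ y) ⊛ Q ⊛ u₁)
        ∎)
    where
    c : FPS
    c = x ⊛ (𝟙 ⊖ x) ^^ 4
    [PQ]²u₁u₂≈1 : (P ⊛ Q) ^^ 2 ⊛ (u₁ ⊛ u₂) ≈ 𝟙
    [PQ]²u₁u₂≈1 = begin
      (P ⊛ Q) ^^ 2 ⊛ (u₁ ⊛ u₂)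
        ≈⟨ solve 4 (λ P Q u₁ u₂ → (P :* Q) :^ 2 :* (u₁ :* u₂) := P :* P :* u₁ :* (Q :* Q :* u₂))
             ≈-refl P Q u₁ u₂ ⟩
      P ⊛ P ⊛ u₁ ⊛ (Q ⊛ Q ⊛ u₂) ≈⟨ *-cong P²u₁≈1 Q²u₂≈1 ⟩
      𝟙 ⊛ 𝟙                     ≈⟨ *-identityˡ 𝟙 ⟩
      𝟙                         ∎

module Recursion (g R S x : FPS)
  (S-eq : S ≈ 𝟚 ⊛ g ⊛ R ⊕ g ⊛ S ^^ 2)
  (R-eq : R ≈ 𝟙 ⊕ 𝟚 ⊛ g ⊛ R ⊛ S)
  (x-eq : x ≈ g ^^ 2 ⊛ R ^^ 3 ⊛ (𝟙 ⊕ x) ^^ 2)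
  where

  R[1-2gS]≈1 : R ⊛ (𝟙 ⊖ 𝟚 ⊛ g ⊛ S) ≈ 𝟙
  R[1-2gS]≈1 = begin
    R ⊛ (𝟙 ⊖ 𝟚 ⊛ g ⊛ S)
      ≈⟨ solve 3 (λ g R S → R :* (con 1ℚ :- con (1ℚ + 1ℚ) :* g :* S) := R :- con (1ℚ + 1ℚ) :* g :* R :* S)
           ≈-refl g R S ⟩
    R ⊖ 𝟚 ⊛ g ⊛ R ⊛ S                 ≈⟨ +-congʳ {⊝ (𝟚 ⊛ g ⊛ R ⊛ S)} R-eq ⟩
    𝟙 ⊕ 𝟚 ⊛ g ⊛ R ⊛ S ⊖ 𝟚 ⊛ g ⊛ R ⊛ S ≈⟨ solve 1 (λ a → con 1ℚ :+ a :- a := con 1ℚ) ≈-refl (𝟚 ⊛ g ⊛ R ⊛ S) ⟩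
    𝟙                                 ∎

  S-gS²≈2gR : S ⊖ g ⊛ S ^^ 2 ≈ 𝟚 ⊛ g ⊛ R
  S-gS²≈2gR = begin
    S ⊖ g ⊛ S ^^ 2                      ≈⟨ +-congʳ {⊝ (g ⊛ S ^^ 2)} S-eq ⟩
    𝟚 ⊛ g ⊛ R ⊕ g ⊛ S ^^ 2 ⊖ g ⊛ S ^^ 2
      ≈⟨ solve 2 (λ a b → a :+ b :- b := a) ≈-refl (𝟚 ⊛ g ⊛ R) (g ⊛ S ^^ 2) ⟩
    𝟚 ⊛ g ⊛ R                           ∎

  g²R³κ[1+x]≈x[1-x]² : g ^^ 2 ⊛ R ^^ 3 ⊛ κ x ⊛ (𝟙 ⊕ x) ≈ x ⊛ (𝟙 ⊖ x) ^^ 2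
  g²R³κ[1+x]≈x[1-x]² = begin
    g ^^ 2 ⊛ R ^^ 3 ⊛ κ x ⊛ (𝟙 ⊕ x)
      ≈⟨ solve 3 (λ g R x →
              g :^ 2 :* R :^ 3 :* ((con 1ℚ :- x) :* (con 1ℚ :- x :^ 2)) :* (con 1ℚ :+ x)
           := g :^ 2 :* R :^ 3 :* (con 1ℚ :+ x) :^ 2 :* (con 1ℚ :- x) :^ 2) ≈-refl g R x ⟩
    g ^^ 2 ⊛ R ^^ 3 ⊛ (𝟙 ⊕ x) ^^ 2 ⊛ (𝟙 ⊖ x) ^^ 2 ≈⟨ *-congʳ {(𝟙 ⊖ x) ^^ 2} x-eq ⟨
    x ⊛ (𝟙 ⊖ x) ^^ 2                               ∎

  -- S[ xⁿ , 1/((1 - x^{n+1})(1 - x^{n+2})) ] is S_n.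
  S[_,_] : FPS → FPS → FPS
  S[ y , w ] = S ⊖ g ⊛ R ^^ 2 ⊛ (𝟙 ⊖ x) ⊛ (𝟙 ⊖ x ^^ 2) ⊛ y ⊛ w

  S-quadratic : ∀ y w → S[ y , w ]
    ≈ g ⊛ R ⊛ (𝟚 ⊖ κ x ⊛ (y ⊛ w) ⊖ x ⊛ (𝟙 ⊖ x) ^^ 4 ⊛ (y ⊛ w) ^^ 2) ⊕ g ⊛ S[ y , w ] ^^ 2
  S-quadratic y w = begin
    S[ y , w ]
      ≈⟨ solve 6 (λ g R S x y w →
           let z  = y :* w
               κ  = (con 1ℚ :- x) :* (con 1ℚ :- x :^ 2)
               S′ = S :- g :* R :^ 2 :* (con 1ℚ :- x) :* (con 1ℚ :- x :^ 2) :* y :* w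
           in     S′
               := S :- g :* S :^ 2 :- g :* R :* κ :* z :* (R :* (con 1ℚ :- con (1ℚ + 1ℚ) :* g :* S))
                    :- g :* R :* (g :^ 2 :* R :^ 3 :* κ :* (con 1ℚ :+ x)) :* ((con 1ℚ :- x) :^ 2 :* z :^ 2)
                    :+ g :* S′ :^ 2) ≈-refl g R S x y w ⟩
    S ⊖ g ⊛ S ^^ 2 ⊖ gRκz ⊛ (R ⊛ (𝟙 ⊖ 𝟚 ⊛ g ⊛ S))
      ⊖ g ⊛ R ⊛ (g ^^ 2 ⊛ R ^^ 3 ⊛ κ x ⊛ (𝟙 ⊕ x)) ⊛ [1-x]²z² ⊕ g ⊛ S[ y , w ] ^^ 2
      ≈⟨ +-congʳ {g ⊛ S[ y , w ] ^^ 2}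
           (+-cong (+-cong S-gS²≈2gR (-‿cong (*-congˡ {gRκz} R[1-2gS]≈1)))
                   (-‿cong (*-congʳ {[1-x]²z²} (*-congˡ {g ⊛ R} g²R³κ[1+x]≈x[1-x]²)))) ⟩
    𝟚 ⊛ g ⊛ R ⊖ gRκz ⊛ 𝟙 ⊖ g ⊛ R ⊛ (x ⊛ (𝟙 ⊖ x) ^^ 2) ⊛ [1-x]²z² ⊕ g ⊛ S[ y , w ] ^^ 2
      ≈⟨ +-congʳ {g ⊛ S[ y , w ] ^^ 2} (solve 4 (λ g R x z →
              con (1ℚ + 1ℚ) :* g :* R :- g :* R :* ((con 1ℚ :- x) :* (con 1ℚ :- x :^ 2)) :* z :* con 1ℚ
                :- g :* R :* (x :* (con 1ℚ :- x) :^ 2) :* ((con 1ℚ :- x) :^ 2 :* z :^ 2)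
           := g :* R :* (con (1ℚ + 1ℚ) :- (con 1ℚ :- x) :* (con 1ℚ :- x :^ 2) :* z
                         :- x :* (con 1ℚ :- x) :^ 4 :* z :^ 2))
           ≈-refl g R x (y ⊛ w)) ⟩
    g ⊛ R ⊛ (𝟚 ⊖ κ x ⊛ (y ⊛ w) ⊖ x ⊛ (𝟙 ⊖ x) ^^ 4 ⊛ (y ⊛ w) ^^ 2) ⊕ g ⊛ S[ y , w ] ^^ 2
      ∎
    where
    gRκz [1-x]²z² : FPS
    gRκz     = g ⊛ R ⊛ κ x ⊛ (y ⊛ w)
    [1-x]²z² = (𝟙 ⊖ x) ^^ 2 ⊛ (y ⊛ w) ^^ 2

  module _ (y : FPS) where
    open Denominators x y

    S-recursion : ∀ {u₁ u₂ w} → P ⊛ P ⊛ u₁ ≈ 𝟙 → Q ⊛ Q ⊛ u₂ ≈ 𝟙 → P ⊛ Q ⊛ w ≈ 𝟙 →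
      S[ y , w ] ≈ g ⊛ (R ⊛ P ⊛ T ⊛ u₂ ⊕ R ⊛ (𝟙 ⊖ y) ⊛ Q ⊛ u₁) ⊕ g ⊛ S[ y , w ] ^^ 2
    S-recursion {u₁} {u₂} {w} P²u₁≈1 Q²u₂≈1 PQw≈1 = begin
      S[ y , w ]
        ≈⟨ S-quadratic y w ⟩
      g ⊛ R ⊛ (𝟚 ⊖ κ x ⊛ (y ⊛ w) ⊖ x ⊛ (𝟙 ⊖ x) ^^ 4 ⊛ (y ⊛ w) ^^ 2) ⊕ g ⊛ S[ y , w ] ^^ 2
        ≈⟨ +-congʳ {g ⊛ S[ y , w ] ^^ 2} (*-congˡ {g ⊛ R}
             (2-κz-x[1-x]⁴z²≈PT/Q²+[1-y]Q/P² P²u₁≈1 Q²u₂≈1 (fraction-cancel (P ⊛ Q) w PQw≈1 y))) ⟩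
      g ⊛ R ⊛ (P ⊛ T ⊛ u₂ ⊕ (𝟙 ⊖ y) ⊛ Q ⊛ u₁) ⊕ g ⊛ S[ y , w ] ^^ 2
        ≈⟨ +-congʳ {g ⊛ S[ y , w ] ^^ 2} (solve 8 (λ g R y P Q T u₁ u₂ →
                g :* R :* (P :* T :* u₂ :+ (con 1ℚ :- y) :* Q :* u₁)
             := g :* (R :* P :* T :* u₂ :+ R :* (con 1ℚ :- y) :* Q :* u₁)) ≈-refl g R y P Q T u₁ u₂) ⟩
      g ⊛ (R ⊛ P ⊛ T ⊛ u₂ ⊕ R ⊛ (𝟙 ⊖ y) ⊛ Q ⊛ u₁) ⊕ g ⊛ S[ y , w ] ^^ 2
        ∎

    1-g²R³κ·PT[z₀+z₁]/Q²≈PT/Q² : ∀ {u₂ w₀ w₁} → Q ⊛ Q ⊛ u₂ ≈ 𝟙 → P ⊛ Q ⊛ w₀ ≈ 𝟙 → Q ⊛ T ⊛ w₁ ≈ 𝟙 →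
      𝟙 ⊖ g ^^ 2 ⊛ R ^^ 3 ⊛ κ x ⊛ u₂ ⊛ (P ⊛ T ⊛ (y ⊛ w₀ ⊕ x ⊛ y ⊛ w₁)) ≈ P ⊛ T ⊛ u₂
    1-g²R³κ·PT[z₀+z₁]/Q²≈PT/Q² {u₂} {w₀} {w₁} Q²u₂≈1 PQw₀≈1 QTw₁≈1 = begin
      𝟙 ⊖ g ^^ 2 ⊛ R ^^ 3 ⊛ κ x ⊛ u₂ ⊛ (P ⊛ T ⊛ (y ⊛ w₀ ⊕ x ⊛ y ⊛ w₁))
        ≈⟨ +-congˡ {𝟙} (-‿cong (*-congˡ {g ^^ 2 ⊛ R ^^ 3 ⊛ κ x ⊛ u₂} (PT[z₀+z₁]≈[1+x]y Q²u₂≈1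
             (fraction-cancel (P ⊛ Q) w₀ PQw₀≈1 y) (fraction-cancel (Q ⊛ T) w₁ QTw₁≈1 (x ⊛ y))))) ⟩
      𝟙 ⊖ g ^^ 2 ⊛ R ^^ 3 ⊛ κ x ⊛ u₂ ⊛ ((𝟙 ⊕ x) ⊛ y)
        ≈⟨ +-congˡ {𝟙} (-‿cong (solve 5 (λ a κ x y u₂ →
                a :* κ :* u₂ :* ((con 1ℚ :+ x) :* y) := a :* κ :* (con 1ℚ :+ x) :* (y :* u₂))
             ≈-refl (g ^^ 2 ⊛ R ^^ 3) (κ x) x y u₂)) ⟩
      𝟙 ⊖ g ^^ 2 ⊛ R ^^ 3 ⊛ κ x ⊛ (𝟙 ⊕ x) ⊛ (y ⊛ u₂)
        ≈⟨ +-congˡ {𝟙} (-‿cong (*-congʳ {y ⊛ u₂} g²R³κ[1+x]≈x[1-x]²)) ⟩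
      𝟙 ⊖ x ⊛ (𝟙 ⊖ x) ^^ 2 ⊛ (y ⊛ u₂)
        ≈⟨ 1-x[1-x]²y/Q²≈PT/Q² Q²u₂≈1 ⟩
      P ⊛ T ⊛ u₂
        ∎

    R-recursion : ∀ {u₂ w₀ w₁} → Q ⊛ Q ⊛ u₂ ≈ 𝟙 → P ⊛ Q ⊛ w₀ ≈ 𝟙 → Q ⊛ T ⊛ w₁ ≈ 𝟙 →
      R ⊛ P ⊛ T ⊛ u₂ ≈ 𝟙 ⊕ g ⊛ (R ⊛ P ⊛ T ⊛ u₂) ⊛ (S[ x ⊛ y , w₁ ] ⊕ S[ y , w₀ ])
    R-recursion {u₂} {w₀} {w₁} Q²u₂≈1 PQw₀≈1 QTw₁≈1 = ≈-sym (begin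
      𝟙 ⊕ g ⊛ (R ⊛ P ⊛ T ⊛ u₂) ⊛ (S[ x ⊛ y , w₁ ] ⊕ S[ y , w₀ ])
        ≈⟨ solve 10 (λ g R S x y P T u₂ w₀ w₁ →
             let σ = λ v w → g :* R :^ 2 :* (con 1ℚ :- x) :* (con 1ℚ :- x :^ 2) :* v :* w
             in     con 1ℚ :+ g :* (R :* P :* T :* u₂) :* (S :- σ (x :* y) w₁ :+ (S :- σ y w₀))
                 := con 1ℚ :- g :^ 2 :* R :^ 3 :* ((con 1ℚ :- x) :* (con 1ℚ :- x :^ 2)) :* u₂
                                :* (P :* T :* (y :* w₀ :+ x :* y :* w₁))
                      :+ con (1ℚ + 1ℚ) :* g :* S :* (R :* P :* T :* u₂))
             ≈-refl g R S x y P T u₂ w₀ w₁ ⟩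
      𝟙 ⊖ g ^^ 2 ⊛ R ^^ 3 ⊛ κ x ⊛ u₂ ⊛ (P ⊛ T ⊛ (y ⊛ w₀ ⊕ x ⊛ y ⊛ w₁)) ⊕ 2gSRₙ
        ≈⟨ +-congʳ {2gSRₙ} (1-g²R³κ·PT[z₀+z₁]/Q²≈PT/Q² Q²u₂≈1 PQw₀≈1 QTw₁≈1) ⟩
      P ⊛ T ⊛ u₂ ⊕ 2gSRₙ
        ≈⟨ +-congʳ {2gSRₙ} (absorbʳ (P ⊛ T ⊛ u₂) R[1-2gS]≈1) ⟨
      P ⊛ T ⊛ u₂ ⊛ (R ⊛ (𝟙 ⊖ 𝟚 ⊛ g ⊛ S)) ⊕ 2gSRₙ
        ≈⟨ solve 6 (λ g R S P T u₂ →
                P :* T :* u₂ :* (R :* (con 1ℚ :- con (1ℚ + 1ℚ) :* g :* S))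
                  :+ con (1ℚ + 1ℚ) :* g :* S :* (R :* P :* T :* u₂)
             := R :* P :* T :* u₂) ≈-refl g R S P T u₂ ⟩
      R ⊛ P ⊛ T ⊛ u₂
        ∎)
      where
      2gSRₙ : FPS
      2gSRₙ = 𝟚 ⊛ g ⊛ S ⊛ (R ⊛ P ⊛ T ⊛ u₂)

-- The normalisations R₀ = 1 and S₀ = 0 only single out the solution; the
-- recursions hold for every solution of the system.
mainTheorem1 : (R S x : FPS) →
    R 0 ≡ 1ℚ → S 0 ≡ 0ℚ →
    S ≈ 𝟚 ⊛ gvar ⊛ R ⊕ gvar ⊛ S ^^ 2 →
    R ≈ 𝟙 ⊕ 𝟚 ⊛ gvar ⊛ R ⊛ S →
    x 0 ≡ 0ℚ →
    x ≈ gvar ^^ 2 ⊛ R ^^ 3 ⊛ (𝟙 ⊕ x) ^^ 2 →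
    (n : ℕ) →
      (Sn R S x n ≈ gvar ⊛ (Rs R x (suc n) ⊕ Rs R x n) ⊕ gvar ⊛ Sn R S x n ^^ 2)
      × (Rs R x (suc n) ≈ 𝟙 ⊕ gvar ⊛ Rs R x (suc n) ⊛ (Sn R S x (suc n) ⊕ Sn R S x n))
mainTheorem1 R S x _ _ S-eq R-eq x₀≡0 x-eq n =
  S-recursion y (inverse P P P₀ P₀) (inverse Q Q Q₀ Q₀) (inverse P Q P₀ Q₀) ,
  R-recursion y (inverse Q Q Q₀ Q₀) (inverse P Q P₀ Q₀) (inverse Q T Q₀ T₀)
  where
  y : FPS
  y = x ^^ n
  open Recursion gvar R S x S-eq R-eq x-eq
  open Denominators x y

  P₀ : P 0 ≡ 1ℚ
  P₀ = 1⊖-coeff₀ x y x₀≡0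
  Q₀ : Q 0 ≡ 1ℚ
  Q₀ = 1⊖-coeff₀ x (x ⊛ y) x₀≡0
  T₀ : T 0 ≡ 1ℚ
  T₀ = 1⊖-coeff₀ x (x ⊛ (x ⊛ y)) x₀≡0

  inverse : ∀ a b → a 0 ≡ 1ℚ → b 0 ≡ 1ℚ → a ⊛ b ⊛ inv1 (a ⊛ b) ≈ 𝟙
  inverse a b a₀≡1 b₀≡1 = inv1-inverse (a ⊛ b) (⊛-coeff₀ a b a₀≡1 b₀≡1)
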